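{- Every face of an alternating map contains an equal number of sources and sinks. If an alternating map is acyclic (has no directed cycle), then each of its faces contains both a source and a sink.
   Context: A map is a connected graph cellularly embedded in a closed orientable surface. An alternating map is a map of a directed graph such that the edges encountered in cyclic order around any vertex alternate in direction (out, in, out, ...); consequently every non-leaf vertex has both in- and out-edges, and the sources and sinks are exactly the out-directed and in-directed leaves. A vertex is contained in a face if it lies on the boundary walk of that face, counted according to its occurrences on the boundary walk. -}

module Defs where

open import Data.Nat using (ℕ; zero; suc)
open import Data.Fin using (Fin; _≟_)
open import Data.Fin.Permutation using (Permutation′; _⟨$⟩ʳ_)
open import Data.Bool using (Bool; true; false; not; _∧_; _∨_)
import Data.Bool
open import Data.List using (List; length; filter; allFin; upTo)
open import Data.Bool.ListAction using (any; all)
open import Data.Sum using (_⊎_)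
open import Relation.Nullary using (¬_)
open import Relation.Nullary.Decidable using (⌊_⌋)
open import Relation.Binary.PropositionalEquality using (_≡_)
open import Relation.Binary.Construct.Closure.ReflexiveTransitive using (Star)
open import Relation.Binary.Construct.Closure.Transitive using (TransClosure)
open import Data.Product using (Σ; ∃; _×_)

iter : ∀ {A : Set} → (A → A) → ℕ → A → A
iter f zero    x = x
iter f (suc k) x = f (iter f k x)

-- A map with n darts (half-edges), as a combinatorial map (rotation system):
--   σ : rotation around vertices (vertices = σ-orbits),
--   α : fixed-point-free involution pairing the two darts of an edge,
--   faces = orbits of φ = σ ∘ α; the darts of a face orbit are exactly the
--   corners of its boundary walk, so each dart in the orbit is one occurrence
--   of its vertex on that boundary walk.
data Gen {n : ℕ} (σ α : Fin n → Fin n) : Fin n → Fin n → Set where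
  byσ : ∀ d → Gen σ α d (σ d)
  byα : ∀ d → Gen σ α d (α d)

record Map (n : ℕ) : Set where
  field
    σ        : Permutation′ n
    α        : Permutation′ n
    α-invol  : ∀ d → α ⟨$⟩ʳ (α ⟨$⟩ʳ d) ≡ d
    α-nofix  : ∀ d → ¬ (α ⟨$⟩ʳ d ≡ d)
    connected : ∀ d d′ → Star (Gen (σ ⟨$⟩ʳ_) (α ⟨$⟩ʳ_)) d d′

  s : Fin n → Fin n
  s = σ ⟨$⟩ʳ_

  a : Fin n → Fin n
  a = α ⟨$⟩ʳ_

  φ : Fin n → Fin n
  φ d = s (a d)

  -- d′ lies in the σ-orbit of d (same vertex).  Orbits of a permutation of
  -- Fin n have length ≤ n, so searching k < n is exact.
  sameVertex : Fin n → Fin n → Bool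
  sameVertex d d′ = any (λ k → ⌊ iter s k d ≟ d′ ⌋) (upTo n)

  sameFace : Fin n → Fin n → Bool
  sameFace d d′ = any (λ k → ⌊ iter φ k d ≟ d′ ⌋) (upTo n)

-- A directed map: each edge is oriented; `out d` says dart d is the tail
-- half of its edge.  Alternating: around each vertex consecutive darts
-- alternate in direction (vacuous at leaves, where σ d ≡ d).
record AlternatingMap (n : ℕ) : Set where
  field
    baseMap      : Map n
    out          : Fin n → Bool
  open Map baseMap public
  field
    out-α        : ∀ d → out (a d) ≡ not (out d)
    alternating  : ∀ d → ¬ (s d ≡ d) → out (s d) ≡ not (out d)

  isSource : Fin n → Bool
  isSource d = all (λ k → out (iter s k d)) (upTo n)

  isSink : Fin n → Bool
  isSink d = all (λ k → not (out (iter s k d))) (upTo n)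

  -- Number of occurrences of sources (resp. sinks) on the boundary walk of
  -- the face containing dart f (counted with multiplicity = corners).
  #sourcesInFace : Fin n → ℕ
  #sourcesInFace f = length (filter (λ d → Data.Bool._≟_ (sameFace f d ∧ isSource d) true) (allFin n))
  #sinksInFace : Fin n → ℕ
  #sinksInFace f = length (filter (λ d → Data.Bool._≟_ (sameFace f d ∧ isSink d) true) (allFin n))

  -- One directed step along an edge: d is an out-dart (tail at its vertex),
  -- and d′ is an out-dart at the head vertex of d's edge.
  DStep : Fin n → Fin n → Set
  DStep d d′ = out d ≡ true × sameVertex (a d) d′ ≡ true × out d′ ≡ true

  HasDirectedCycle : Set
  HasDirectedCycle = ∃ λ d → TransClosure DStep d d

  Acyclic : Set
  Acyclic = ¬ HasDirectedCycle

-- Read the boundary walk of a face as the cyclic sequence of its darts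
-- d, φ d, φ² d, …, each labelled out or in.  Since the map is alternating,
-- out (φ d) ≡ out d unless the vertex of φ d is a leaf, where the label
-- flips; and a leaf is a source or a sink according to the label of its
-- dart.  So the sources on a face are the in→out switches and the sinks the
-- out→in switches of a cyclic binary sequence, and these are equinumerous.
-- If there are no switches, all darts of the face point the same way and
-- walking around the face (forwards along out-darts, or backwards along the
-- opposite darts of in-darts) is a directed closed walk.
module Submission where

open import Defs
open import Data.Nat using (ℕ; zero; suc; _+_; _*_; _∸_; _≤_; z≤n; s≤s)
open import Data.Nat.Properties
  using (+-0-commutativeMonoid; +-suc; +-cancelˡ-≡; m+n≡0⇒n≡0; n<1+n; <⇒≤; ≤-trans; ≤-pred
        ; m∸n≤m; m<n⇒0<n∸m; m+[n∸m]≡n)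
open import Data.Nat.DivMod using (_%_; _/_; m≡m%n+[m/n]*n; m%n<n)
open import Data.Fin as Fin using (Fin; toℕ; _≟_)
open import Data.Fin.Properties using (pigeonhole; toℕ<n)
open import Data.Fin.Permutation using (Permutation′; _⟨$⟩ʳ_; _∘ₚ_)
open import Data.Bool as Bool using (Bool; true; false; not; _∧_)
open import Data.Bool.Properties
  using (∧-identityʳ; ∧-idem; ∧-assoc; ∧-inverseˡ; ∧-inverseʳ; not-involutive; T-≡; ⇔→≡)
open import Data.Bool.ListAction using (any; all)
open import Data.List using ([]; _∷_; length; filter; tabulate; allFin; upTo; applyUpTo)
open import Data.List.Membership.Propositional using (find; lose)
open import Data.List.Membership.Propositional.Properties using (∈-upTo⁺)
open import Data.List.Relation.Unary.Any.Properties using (any⁺; any⁻)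
open import Data.Product using (∃; _×_; _,_)
open import Data.Empty using (⊥-elim)
open import Relation.Nullary using (yes; no)
open import Relation.Nullary.Decidable using (⌊_⌋; toWitness; fromWitness)
open import Relation.Binary.PropositionalEquality
  using (_≡_; _≢_; refl; sym; trans; cong; cong₂; subst; module ≡-Reasoning)
open import Relation.Binary.Construct.Closure.Transitive using (TransClosure; [_]; _∷_; _∷ʳ_)
open import Function using (_∘_; id)
open import Function.Bundles using (Injection; Equivalence; mk⇔)
open import Function.Properties.Inverse using (↔⇒↣)
import Algebra.Properties.CommutativeMonoid.Sum as CommutativeMonoidSum

open Equivalence using (to; from)
open CommutativeMonoidSum +-0-commutativeMonoid using (sum; sum-permute; sum-cong-≗; ∑-distrib-+)

module _ {A : Set} (g : A → A) where

  iter-+ : ∀ j k x → iter g (j + k) x ≡ iter g j (iter g k x)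
  iter-+ zero    k x = refl
  iter-+ (suc j) k x = cong g (iter-+ j k x)

  iter-commute : ∀ k x → iter g k (g x) ≡ g (iter g k x)
  iter-commute zero    x = refl
  iter-commute (suc k) x = cong g (iter-commute k x)

  iter-injective : (∀ {x y} → g x ≡ g y → x ≡ y) → ∀ k {x y} → iter g k x ≡ iter g k y → x ≡ y
  iter-injective g-inj zero    e = e
  iter-injective g-inj (suc k) e = iter-injective g-inj k (g-inj e)

  iter-fixed : ∀ {x} → g x ≡ x → ∀ k → iter g k x ≡ x
  iter-fixed e zero    = refl
  iter-fixed e (suc k) = trans (cong g (iter-fixed e k)) e

  iter-*-period : ∀ {p x} → iter g p x ≡ x → ∀ q → iter g (q * p) x ≡ x
  iter-*-period e zero    = refl
  iter-*-period {p} {x} e (suc q) =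
    trans (iter-+ p (q * p) x) (trans (cong (iter g p) (iter-*-period e q)) e)

  iter-%-period : ∀ {q x} → iter g (suc q) x ≡ x → ∀ m → iter g (m % suc q) x ≡ iter g m x
  iter-%-period {q} {x} e m = sym (begin
    iter g m x                                          ≡⟨ cong (λ t → iter g t x) (m≡m%n+[m/n]*n m (suc q)) ⟩
    iter g (m % suc q + m / suc q * suc q) x            ≡⟨ iter-+ (m % suc q) (m / suc q * suc q) x ⟩
    iter g (m % suc q) (iter g (m / suc q * suc q) x)   ≡⟨ cong (iter g (m % suc q)) (iter-*-period e (m / suc q)) ⟩
    iter g (m % suc q) x                                ∎)
    where open ≡-Reasoning

module Orbit {n : ℕ} (g : Fin n → Fin n) (g-injective : ∀ {x y} → g x ≡ g y → x ≡ y) where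

  period : ∀ x → ∃ λ q → suc q ≤ n × iter g (suc q) x ≡ x
  period x with pigeonhole (n<1+n n) (λ i → iter g (toℕ i) x)
  ... | i , j , i<j , eᵢⱼ with toℕ j ∸ toℕ i in eq | m<n⇒0<n∸m i<j
  ...   | zero  | ()
  ...   | suc q | _ = q , subst (_≤ n) eq (≤-trans (m∸n≤m (toℕ j) (toℕ i)) (≤-pred (toℕ<n j))) , sym returns
    where
    returns : x ≡ iter g (suc q) x
    returns = iter-injective g g-injective (toℕ i) (begin
      iter g (toℕ i) x                           ≡⟨ eᵢⱼ ⟩
      iter g (toℕ j) x                           ≡⟨ cong (λ t → iter g t x) (sym (m+[n∸m]≡n (<⇒≤ i<j))) ⟩
      iter g (toℕ i + (toℕ j ∸ toℕ i)) x         ≡⟨ iter-+ g (toℕ i) (toℕ j ∸ toℕ i) x ⟩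
      iter g (toℕ i) (iter g (toℕ j ∸ toℕ i) x)  ≡⟨ cong (λ t → iter g (toℕ i) (iter g t x)) eq ⟩
      iter g (toℕ i) (iter g (suc q) x)          ∎)
      where open ≡-Reasoning

  orbit : Fin n → Fin n → Bool
  orbit x y = any (λ k → ⌊ iter g k x ≟ y ⌋) (upTo n)

  orbit-iter : ∀ x m → orbit x (iter g m x) ≡ true
  orbit-iter x m with period x
  ... | q , q<n , e = to T-≡ (any⁺ _ (lose (∈-upTo⁺ (≤-trans (m%n<n m (suc q)) q<n))
                                          (fromWitness (iter-%-period g e m))))

  orbit⇒iter : ∀ {x y} → orbit x y ≡ true → ∃ λ k → iter g k x ≡ y
  orbit⇒iter e with find (any⁻ _ (upTo n) (from T-≡ e))
  ... | k , _ , found = k , toWitness found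

  orbit-pred : ∀ x → orbit (g x) x ≡ true
  orbit-pred x with period x
  ... | q , _ , e = subst (λ y → orbit (g x) y ≡ true) (trans (iter-commute g q x) e) (orbit-iter (g x) q)

  orbit-step : ∀ x y → orbit x (g y) ≡ orbit x y
  orbit-step x y = ⇔→≡ (mk⇔ shrink grow)
    where
    grow : orbit x y ≡ true → orbit x (g y) ≡ true
    grow e with orbit⇒iter e
    ... | k , eₖ = subst (λ z → orbit x z ≡ true) (cong g eₖ) (orbit-iter x (suc k))

    -- y is reached one step before g y, going once more around the cycle of x.
    shrink : orbit x (g y) ≡ true → orbit x y ≡ true
    shrink e with orbit⇒iter e | period x
    ... | k , eₖ | q , _ , eq = subst (λ z → orbit x z ≡ true) (g-injective (begin
      g (iter g (k + q) x)         ≡⟨ cong (λ t → iter g t x) (sym (+-suc k q)) ⟩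
      iter g (k + suc q) x         ≡⟨ iter-+ g k (suc q) x ⟩
      iter g k (iter g (suc q) x)  ≡⟨ cong (iter g k) eq ⟩
      iter g k x                   ≡⟨ eₖ ⟩
      g y                          ∎)) (orbit-iter x (k + q))
      where open ≡-Reasoning

𝟙 : Bool → ℕ
𝟙 true  = 1
𝟙 false = 0

length-filter-tabulate : ∀ {m k} (h : Fin m → Fin k) (p : Fin k → Bool)
  → length (filter (λ d → p d Bool.≟ true) (tabulate h)) ≡ sum (𝟙 ∘ p ∘ h)
length-filter-tabulate {zero}  h p = refl
length-filter-tabulate {suc m} h p with p (h Fin.zero)
... | true  = cong suc (length-filter-tabulate (h ∘ Fin.suc) p)
... | false = length-filter-tabulate (h ∘ Fin.suc) p

length-filter-allFin : ∀ {m} (p : Fin m → Bool)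
  → length (filter (λ d → p d Bool.≟ true) (allFin m)) ≡ sum (𝟙 ∘ p)
length-filter-allFin = length-filter-tabulate id

sum-𝟙≡0 : ∀ {m} (p : Fin m → Bool) → sum (𝟙 ∘ p) ≡ 0 → ∀ i → p i ≡ false
sum-𝟙≡0 {suc m} p e Fin.zero with p Fin.zero
... | false = refl
... | true with () ← e
sum-𝟙≡0 {suc m} p e (Fin.suc i) = sum-𝟙≡0 (p ∘ Fin.suc) (m+n≡0⇒n≡0 (𝟙 (p Fin.zero)) e) i

sum-𝟙≡suc : ∀ {m} (p : Fin m → Bool) {k} → sum (𝟙 ∘ p) ≡ suc k → ∃ λ i → p i ≡ true
sum-𝟙≡suc {suc m} p e with p Fin.zero in p₀
... | true  = Fin.zero , p₀
... | false with sum-𝟙≡suc (p ∘ Fin.suc) e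
...   | i , pᵢ = Fin.suc i , pᵢ

∧≡true : ∀ x {y} → x ∧ y ≡ true → x ≡ true × y ≡ true
∧≡true true e = refl , e

-- Both sides equal 𝟙 (c ∧ (x ∨ y)).
𝟙-switch : ∀ c x y → 𝟙 (c ∧ y) + 𝟙 (c ∧ (x ∧ not y)) ≡ 𝟙 (c ∧ x) + 𝟙 (c ∧ (not x ∧ y))
𝟙-switch false x     y     = refl
𝟙-switch true  true  true  = refl
𝟙-switch true  true  false = refl
𝟙-switch true  false true  = refl
𝟙-switch true  false false = refl

no-switch⇒≡ : ∀ x y → not x ∧ y ≡ false → x ∧ not y ≡ false → y ≡ x
no-switch⇒≡ true  true  _ _ = refl
no-switch⇒≡ false false _ _ = refl

module CyclicCount {n : ℕ} (π : Permutation′ n) (χ : Fin n → Bool) (χ-π : ∀ d → χ (π ⟨$⟩ʳ d) ≡ χ d) where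

  mark : (Fin n → Bool) → Fin n → ℕ
  mark p d = 𝟙 (χ d ∧ p d)

  count : (Fin n → Bool) → ℕ
  count p = sum (mark p)

  count-cong : ∀ {p q} → (∀ d → p d ≡ q d) → count p ≡ count q
  count-cong p≗q = sum-cong-≗ (λ d → cong (λ b → 𝟙 (χ d ∧ b)) (p≗q d))

  count-∘π : ∀ p → count (λ d → p (π ⟨$⟩ʳ d)) ≡ count p
  count-∘π p = sym (trans (sum-permute _ π) (sum-cong-≗ (λ d → cong (λ c → 𝟙 (c ∧ p (π ⟨$⟩ʳ d))) (χ-π d))))

  count≡suc⇒∃ : ∀ p {k} → count p ≡ suc k → ∃ λ d → χ d ≡ true × p d ≡ true
  count≡suc⇒∃ p e with sum-𝟙≡suc (λ d → χ d ∧ p d) e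
  ... | d , χd∧pd = d , ∧≡true (χ d) χd∧pd

  ascent descent : (Fin n → Bool) → Fin n → Bool
  ascent  b d = not (b d) ∧ b (π ⟨$⟩ʳ d)
  descent b d = b d ∧ not (b (π ⟨$⟩ʳ d))

  count-descent≡count-ascent : ∀ b → count (descent b) ≡ count (ascent b)
  count-descent≡count-ascent b = +-cancelˡ-≡ (count b) _ _ (begin
    count b + count (descent b)
      ≡⟨ cong (_+ count (descent b)) (sym (count-∘π b)) ⟩
    count (λ d → b (π ⟨$⟩ʳ d)) + count (descent b)
      ≡⟨ sym (∑-distrib-+ (mark (λ d → b (π ⟨$⟩ʳ d))) (mark (descent b))) ⟩
    sum (λ d → mark (λ d → b (π ⟨$⟩ʳ d)) d + mark (descent b) d)
      ≡⟨ sum-cong-≗ (λ d → 𝟙-switch (χ d) (b d) (b (π ⟨$⟩ʳ d))) ⟩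
    sum (λ d → mark b d + mark (ascent b) d)
      ≡⟨ ∑-distrib-+ (mark b) (mark (ascent b)) ⟩
    count b + count (ascent b)
      ∎)
    where open ≡-Reasoning

  no-ascent⇒π-invariant : ∀ b → count (ascent b) ≡ 0 → ∀ d → χ d ≡ true → b (π ⟨$⟩ʳ d) ≡ b d
  no-ascent⇒π-invariant b e d χd = no-switch⇒≡ (b d) (b (π ⟨$⟩ʳ d))
    (subst (λ c → c ∧ ascent b d ≡ false) χd (sum-𝟙≡0 _ e d))
    (subst (λ c → c ∧ descent b d ≡ false) χd (sum-𝟙≡0 _ (trans (count-descent≡count-ascent b) e) d))

all-∷-const : ∀ (q : ℕ → Bool) {b} x xs → (∀ k → q k ≡ b) → all q (x ∷ xs) ≡ b
all-∷-const q x []       q≗b = trans (cong (_∧ true) (q≗b x)) (∧-identityʳ _)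
all-∷-const q x (y ∷ ys) q≗b = trans (cong₂ _∧_ (q≗b x) (all-∷-const q y ys q≗b)) (∧-idem _)

all-upTo-const : ∀ {m} (q : ℕ → Bool) {b} → 1 ≤ m → (∀ k → q k ≡ b) → all q (upTo m) ≡ b
all-upTo-const {suc m} q _ = all-∷-const q 0 (applyUpTo suc m)

all-upTo-alternating : ∀ {m} (q : ℕ → Bool) → 2 ≤ m → q 1 ≡ not (q 0) → all q (upTo m) ≡ false
all-upTo-alternating {suc zero}    q (s≤s ()) e
all-upTo-alternating {suc (suc m)} q _ e = begin
  q 0 ∧ (q 1 ∧ rest)          ≡⟨ cong (λ b → q 0 ∧ (b ∧ rest)) e ⟩
  q 0 ∧ (not (q 0) ∧ rest)    ≡⟨ sym (∧-assoc (q 0) (not (q 0)) rest) ⟩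
  (q 0 ∧ not (q 0)) ∧ rest    ≡⟨ cong (_∧ rest) (∧-inverseʳ (q 0)) ⟩
  false                       ∎
  where
  open ≡-Reasoning
  rest : Bool
  rest = all q (applyUpTo (suc ∘ suc) m)

distinct⇒2≤ : ∀ {m} {x y : Fin m} → x ≢ y → 2 ≤ m
distinct⇒2≤ {suc zero}    {Fin.zero} {Fin.zero} x≢y = ⊥-elim (x≢y refl)
distinct⇒2≤ {suc (suc m)} _ = s≤s (s≤s z≤n)

module _ {A : Set} {R : A → A → Set} (w : ℕ → A) where

  forward-walk⁺ : (∀ k → R (w k) (w (suc k))) → ∀ m → TransClosure R (w 0) (w (suc m))
  forward-walk⁺ step zero    = [ step 0 ]
  forward-walk⁺ step (suc m) = forward-walk⁺ step m ∷ʳ step (suc m)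

  backward-walk⁺ : (∀ k → R (w (suc k)) (w k)) → ∀ m → TransClosure R (w (suc m)) (w 0)
  backward-walk⁺ step zero    = [ step 0 ]
  backward-walk⁺ step (suc m) = step (suc m) ∷ backward-walk⁺ step m

module _ {n : ℕ} (M : AlternatingMap n) where
  open AlternatingMap M

  s-injective : ∀ {x y} → s x ≡ s y → x ≡ y
  s-injective = Injection.injective (↔⇒↣ σ)

  φ-injective : ∀ {x y} → φ x ≡ φ y → x ≡ y
  φ-injective = Injection.injective (↔⇒↣ α) ∘ s-injective

  2≤n : Fin n → 2 ≤ n
  2≤n d = distinct⇒2≤ (α-nofix d)

  isSource-leaf : ∀ {d} → s d ≡ d → isSource d ≡ out d
  isSource-leaf {d} leaf = all-upTo-const _ (<⇒≤ (2≤n d)) (λ k → cong out (iter-fixed s leaf k))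

  isSink-leaf : ∀ {d} → s d ≡ d → isSink d ≡ not (out d)
  isSink-leaf {d} leaf = all-upTo-const _ (<⇒≤ (2≤n d)) (λ k → cong (not ∘ out) (iter-fixed s leaf k))

  isSource-nonleaf : ∀ {d} → s d ≢ d → isSource d ≡ false
  isSource-nonleaf {d} nonleaf = all-upTo-alternating _ (2≤n d) (alternating d nonleaf)

  isSink-nonleaf : ∀ {d} → s d ≢ d → isSink d ≡ false
  isSink-nonleaf {d} nonleaf = all-upTo-alternating _ (2≤n d) (cong not (alternating d nonleaf))

  out-φ-leaf : ∀ {d} → s (a d) ≡ a d → out (φ d) ≡ not (out d)
  out-φ-leaf {d} leaf = trans (cong out leaf) (out-α d)

  out-φ-nonleaf : ∀ {d} → s (a d) ≢ a d → out (φ d) ≡ out d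
  out-φ-nonleaf {d} nonleaf =
    trans (alternating (a d) nonleaf) (trans (cong not (out-α d)) (not-involutive (out d)))

  module Vertex = Orbit s s-injective

  φ-permutation : Permutation′ n
  φ-permutation = α ∘ₚ σ

  module Face (f : Fin n) where
    open Orbit φ φ-injective

    sameFace-φ : ∀ d → sameFace f (φ d) ≡ sameFace f d
    sameFace-φ = orbit-step f

    open CyclicCount φ-permutation (sameFace f) sameFace-φ

    isSource-φ : ∀ d → isSource (φ d) ≡ ascent out d
    isSource-φ d with s (a d) ≟ a d
    ... | yes leaf = begin
      isSource (φ d)           ≡⟨ cong isSource leaf ⟩
      isSource (a d)           ≡⟨ isSource-leaf leaf ⟩
      out (a d)                ≡⟨ out-α d ⟩
      not (out d)              ≡⟨ ∧-idem _ ⟨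
      not (out d) ∧ not (out d) ≡⟨ cong (not (out d) ∧_) (out-φ-leaf leaf) ⟨
      not (out d) ∧ out (φ d)  ∎
      where open ≡-Reasoning
    ... | no nonleaf = begin
      isSource (φ d)           ≡⟨ isSource-nonleaf (nonleaf ∘ s-injective) ⟩
      false                    ≡⟨ ∧-inverseˡ (out d) ⟨
      not (out d) ∧ out d      ≡⟨ cong (not (out d) ∧_) (out-φ-nonleaf nonleaf) ⟨
      not (out d) ∧ out (φ d)  ∎
      where open ≡-Reasoning

    isSink-φ : ∀ d → isSink (φ d) ≡ descent out d
    isSink-φ d with s (a d) ≟ a d
    ... | yes leaf = begin
      isSink (φ d)                  ≡⟨ cong isSink leaf ⟩
      isSink (a d)                  ≡⟨ isSink-leaf leaf ⟩
      not (out (a d))               ≡⟨ cong not (out-α d) ⟩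
      not (not (out d))             ≡⟨ not-involutive _ ⟩
      out d                         ≡⟨ ∧-idem _ ⟨
      out d ∧ out d                 ≡⟨ cong (out d ∧_) (not-involutive _) ⟨
      out d ∧ not (not (out d))     ≡⟨ cong (λ b → out d ∧ not b) (out-φ-leaf leaf) ⟨
      out d ∧ not (out (φ d))       ∎
      where open ≡-Reasoning
    ... | no nonleaf = begin
      isSink (φ d)                  ≡⟨ isSink-nonleaf (nonleaf ∘ s-injective) ⟩
      false                         ≡⟨ ∧-inverseʳ (out d) ⟨
      out d ∧ not (out d)           ≡⟨ cong (λ b → out d ∧ not b) (out-φ-nonleaf nonleaf) ⟨
      out d ∧ not (out (φ d))       ∎
      where open ≡-Reasoning

    count-isSource≡count-ascent : count isSource ≡ count (ascent out)
    count-isSource≡count-ascent = trans (sym (count-∘π isSource)) (count-cong isSource-φ)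

    count-isSink≡count-ascent : count isSink ≡ count (ascent out)
    count-isSink≡count-ascent =
      trans (sym (count-∘π isSink)) (trans (count-cong isSink-φ) (count-descent≡count-ascent out))

    #sources≡#sinks : #sourcesInFace f ≡ #sinksInFace f
    #sources≡#sinks = begin
      #sourcesInFace f       ≡⟨ length-filter-allFin (λ d → sameFace f d ∧ isSource d) ⟩
      count isSource         ≡⟨ count-isSource≡count-ascent ⟩
      count (ascent out)     ≡⟨ count-isSink≡count-ascent ⟨
      count isSink           ≡⟨ length-filter-allFin (λ d → sameFace f d ∧ isSink d) ⟨
      #sinksInFace f         ∎
      where open ≡-Reasoning

    out-constant : count (ascent out) ≡ 0 → ∀ k → out (iter φ k f) ≡ out f
    out-constant none zero    = refl
    out-constant none (suc k) =
      trans (no-ascent⇒π-invariant out none (iter φ k f) (orbit-iter f k)) (out-constant none k)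

    out-face⇒cycle : (∀ k → out (iter φ k f) ≡ true) → TransClosure DStep f f
    out-face⇒cycle allOut with period f
    ... | q , _ , e = subst (TransClosure DStep f) e (forward-walk⁺ (λ k → iter φ k f) step q)
      where
      step : ∀ k → DStep (iter φ k f) (iter φ (suc k) f)
      step k = allOut k , Vertex.orbit-iter (a (iter φ k f)) 1 , allOut (suc k)

    in-face⇒cycle : (∀ k → out (iter φ k f) ≡ false) → TransClosure DStep (a f) (a f)
    in-face⇒cycle allIn with period f
    ... | q , _ , e = subst (λ d → TransClosure DStep d (a f)) (cong a e)
                        (backward-walk⁺ (λ k → a (iter φ k f)) step q)
      where
      step : ∀ k → DStep (a (iter φ (suc k) f)) (a (iter φ k f))
      step k = trans (out-α _) (cong not (allIn (suc k)))
             , subst (λ d → sameVertex d (a (iter φ k f)) ≡ true) (sym (α-invol _))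
                 (Vertex.orbit-pred (a (iter φ k f)))
             , trans (out-α _) (cong not (allIn k))

    constant-out⇒cycle : (∀ k → out (iter φ k f) ≡ out f) → HasDirectedCycle
    constant-out⇒cycle constant with out f
    ... | true  = f   , out-face⇒cycle constant
    ... | false = a f , in-face⇒cycle constant

    acyclic⇒source×sink : Acyclic
      → (∃ λ d → sameFace f d ≡ true × isSource d ≡ true) × (∃ λ d → sameFace f d ≡ true × isSink d ≡ true)
    acyclic⇒source×sink acyclic with count (ascent out) in #ascents
    ... | zero  = ⊥-elim (acyclic (constant-out⇒cycle (out-constant #ascents)))
    ... | suc _ = count≡suc⇒∃ isSource (trans count-isSource≡count-ascent #ascents)
                , count≡suc⇒∃ isSink (trans count-isSink≡count-ascent #ascents)

lemma4p2 : ∀ {n : ℕ} (M : AlternatingMap n)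
  → (∀ (f : Fin n) → AlternatingMap.#sourcesInFace M f ≡ AlternatingMap.#sinksInFace M f)
    × (AlternatingMap.Acyclic M
        → ∀ (f : Fin n)
        → (∃ λ d → AlternatingMap.sameFace M f d ≡ true × AlternatingMap.isSource M d ≡ true)
          × (∃ λ d → AlternatingMap.sameFace M f d ≡ true × AlternatingMap.isSink M d ≡ true))
lemma4p2 M = (λ f → Face.#sources≡#sinks M f) , (λ acyclic f → Face.acyclic⇒source×sink M f acyclic)
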